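{- Let $n\ge3$ and $r\ge1$ be integers, and let $T=[C_n,\{f_{v_i}\}_{i=1}^n,\mathrm{id}]\colon\mathbb F_2^n\to\mathbb F_2^n$ with $f_{v_i}\in\{\mathrm{parity}_3,(1+\mathrm{parity})_3\}$ for all $i$. If $T$ has a fixed point and $r$ divides $(2n-2)/\gcd(2,n)$, then $T$ has at least $2$ periodic points of period $r$. If $T$ does not have a fixed point and $(2n-2)/r$ is an odd integer, then $T$ has at least $4$ periodic points of period $r$.
   Context: $C_n$ is the cycle graph with vertices $v_1,\dots,v_n$, $v_i$ adjacent to $v_j$ iff $i-j\equiv\pm1\pmod n$. $\mathrm{parity}_3(x,y,z)=x+y+z$ and $(1+\mathrm{parity})_3(x,y,z)=1+x+y+z$ over $\mathbb F_2$. For $x=(x_1,\dots,x_n)\in\mathbb F_2^n$, the local update $F_{v_i}$ replaces $x_i$ by $f_{v_i}(x_{i-1},x_i,x_{i+1})$ (indices mod $n$) and leaves other coordinates unchanged; $T=F_{v_n}\circ\cdots\circ F_{v_1}$. A periodic point of period $r$ is an $x$ with $T^r(x)=x$ and $T^s(x)\neq x$ for $0<s<r$. -}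

module Defs where

open import Data.Nat using (ℕ; zero; suc; _+_; _*_; _∸_; _<_; _≤_)
open import Data.Nat.DivMod using (_/_)
open import Data.Nat.GCD using (gcd)
open import Data.Nat.Divisibility using (_∣_)
open import Data.Bool using (Bool; true; false; _xor_; not; if_then_else_)
open import Data.Fin using (Fin; zero; suc; toℕ; fromℕ<; _≟_)
open import Data.Nat.DivMod using (_%_; m%n<n)
open import Data.List using (List; length)
open import Data.List.Relation.Unary.All using (All)
import Data.List.Relation.Unary.AllPairs
import Data.Nat
import Data.Nat.GCD
import Data.Sum
open import Data.Product using (Σ; _×_; ∃)
open import Relation.Nullary using (¬_; does)
import Relation.Nullary
open import Relation.Binary.PropositionalEquality using (_≡_)

-- F₂ is modelled by Bool, with addition = xor.
-- A state x ∈ F₂^n is a function Fin n → Bool; index i : Fin n stands for vertex v_{i+1}.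
State : ℕ → Set
State n = Fin n → Bool

module _ {n : ℕ} where
  shift : ℕ → Fin (suc n) → Fin (suc n)
  shift k i = fromℕ< (m%n<n (toℕ i + k) (suc n))

  -- i - 1 mod (n+1)  = i + n mod (n+1)
  prevC : Fin (suc n) → Fin (suc n)
  prevC = shift n
  nextC : Fin (suc n) → Fin (suc n)
  nextC = shift 1

-- local functions: false ↦ parity₃, true ↦ (1+parity)₃
localFun : Bool → Bool → Bool → Bool → Bool
localFun c x y z = c xor (x xor (y xor z))

localUpdate : ∀ {n} → (Fin (suc n) → Bool) → Fin (suc n) → State (suc n) → State (suc n)
localUpdate f i x j =
  if does (j ≟ i) then localFun (f i) (x (prevC i)) (x i) (x (nextC i)) else x j

applyUpTo : ∀ {n} → (Fin (suc n) → Bool) → ℕ → State (suc n) → State (suc n)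
applyUpTo f zero x = x
applyUpTo {n} f (suc m) x with m Data.Nat.<? suc n
... | Relation.Nullary.yes m<n = localUpdate f (fromℕ< m<n) (applyUpTo f m x)
... | Relation.Nullary.no _ = applyUpTo f m x
  where open import Data.Nat using (_<?_)

-- sequential dynamical system map T = F_{v_n} ∘ ⋯ ∘ F_{v_1} on C_n (here n = suc k)
sdsMap : ∀ {n} → (Fin (suc n) → Bool) → State (suc n) → State (suc n)
sdsMap {n} f = applyUpTo f (suc n)

iter : ∀ {A : Set} → ℕ → (A → A) → A → A
iter zero g a = a
iter (suc k) g a = g (iter k g a)

_≈ₛ_ : ∀ {n} → State n → State n → Set
x ≈ₛ y = ∀ i → x i ≡ y i

IsPeriodicPoint : ∀ {n} → (State n → State n) → ℕ → State n → Set
IsPeriodicPoint T r x = (iter r T x ≈ₛ x) × (∀ s → 0 < s → s < r → ¬ (iter s T x ≈ₛ x))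

HasFixedPoint : ∀ {n} → (State n → State n) → Set
HasFixedPoint T = ∃ λ x → T x ≈ₛ x

AtLeastPeriodic : ∀ {n} → ℕ → (State n → State n) → ℕ → Set
AtLeastPeriodic {n} k T r =
  Σ (List (State n)) λ xs →
    (k ≤ length xs) × Data.List.Relation.Unary.AllPairs.AllPairs (λ x y → ¬ (x ≈ₛ y)) xs
    × All (IsPeriodicPoint T r) xs

-- the quantity (2n - 2) / gcd(2, n)  (division is exact)
cycleLen : ℕ → ℕ
cycleLen n = _/_ (2 * n ∸ 2) (gcd 2 n)
  {{Data.Nat.≢-nonZero (Data.Nat.GCD.gcd[m,n]≢0 2 n (Data.Sum.inj₁ (λ ())))}}

-- Number the vertices 0, …, k (k = n - 1), let c_j be the constant of the local function at
-- vertex j and D_j = c_0 + ⋯ + c_j.  One sweep gives T(x)_j = x_0 + x_k + x_{j+1} + D_j for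
-- j < k and T(x)_k = x_1 + D_k + c_0, so up to explicit corrections T is a shift.  Hence the
-- state built from a bit s and a sequence w with w(m + k) = w(m) + τ_s(m), for an explicit
-- twist τ_s, is carried by T^t to the state built from s + tC and w shifted by t, where
-- C = D_k.  Its period is read off from the periods of t ↦ s + tC and of the shifts of w,
-- and suitable w of period r are the indicator of the multiples of r or of h = r/2, the
-- parity of ⌊m/h⌋, and that parity masked by the parity of m.  A fixed point exists exactly
-- when C = 0 and the (then constant) twist can be made 0; this decides which w are admissible.
module Submission where

open import Defs
open import Level using (0ℓ)
open import Data.Bool using (Bool; true; false; not; _∧_; _xor_; if_then_else_)
open import Data.Bool.Properties
  using (xor-∧-commutativeRing; xor-comm; xor-identityʳ; xor-same; xor-inverseʳ; not-involutive; not-distribˡ-xor;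
         not-distribʳ-xor; ¬-not; ∧-identityʳ; ∧-zeroʳ)
  renaming (_≟_ to _≟ᵇ_)
open import Data.Maybe using (Maybe; just; nothing)
open import Data.Nat
  using (ℕ; zero; suc; _+_; _*_; _∸_; _/_; _≤_; _<_; _<?_; z≤n; s≤s; s≤s⁻¹; z<s;
         NonZero; ≢-nonZero; >-nonZero; >-nonZero⁻¹)
open import Data.Nat.Properties hiding (_≟_)
open import Data.Nat.DivMod
  using (_%_; m<n⇒m%n≡m; [m+n]%n≡m%n; n%n≡0; /-congˡ; /-congʳ; n/1≡n; +-distrib-/-∣ʳ; m*n/n≡m; m<n⇒m/n≡0)
open import Data.Nat.Divisibility
  using (_∣_; _∣?_; divides; _∣0; ∣-refl; ∣-antisym; ∣m∣n⇒∣m+n; ∣m+n∣m⇒∣n; ∣⇒≤; n∣m*n)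
open import Data.Nat.GCD using (gcd; gcd[m,n]∣m; gcd[m,n]∣n; gcd-greatest; gcd[m,n]≢0)
open import Data.Nat.Primality using (prime⇒irreducible; prime[2])
open import Data.Sum using (inj₁; inj₂)
open import Data.Fin using (Fin; toℕ; fromℕ<; _≟_)
open import Data.Fin.Properties using (toℕ<n; toℕ-fromℕ<; fromℕ<-toℕ; toℕ-injective)
open import Data.Product using (Σ; _×_; _,_; proj₁; proj₂; ∃-syntax)
open import Data.List using ([]; _∷_)
open import Data.List.Relation.Unary.All using ([]; _∷_)
open import Data.List.Relation.Unary.AllPairs using ([]; _∷_)
open import Function using (_∘_; _$_)
open import Relation.Nullary using (¬_; Dec; does; yes; no; contradiction)
open import Relation.Nullary.Decidable using (dec-true; dec-false)
open import Relation.Binary using (tri<; tri≈; tri>)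
open import Relation.Binary.PropositionalEquality
open import Tactic.RingSolver using (solve-∀)
open import Tactic.RingSolver.Core.AlmostCommutativeRing using (AlmostCommutativeRing; fromCommutativeRing)

open ≡-Reasoning

-- The solver does not see through `not`: solver statements write `not b` as the
-- definitionally equal `true xor b`.
xorRing : AlmostCommutativeRing 0ℓ 0ℓ
xorRing = fromCommutativeRing xor-∧-commutativeRing false≟_
  where
  false≟_ : (b : Bool) → Maybe (false ≡ b)
  false≟ false = just refl
  false≟ true  = nothing

xor-cancelˡ : ∀ a {b c} → a xor b ≡ a xor c → b ≡ c
xor-cancelˡ a {b} {c} eq = begin
  b                 ≡⟨ involutive a b ⟩
  a xor (a xor b)   ≡⟨ cong (a xor_) eq ⟩
  a xor (a xor c)   ≡⟨ involutive a c ⟨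
  c                 ∎
  where
  involutive : ∀ a b → b ≡ a xor (a xor b)
  involutive = solve-∀ xorRing

xor-cancelʳ : ∀ {a b} c → a xor c ≡ b xor c → a ≡ b
xor-cancelʳ {a} {b} c eq = xor-cancelˡ c (trans (xor-comm c a) (trans eq (xor-comm b c)))

odd : ℕ → Bool
odd zero    = false
odd (suc n) = not (odd n)

odd-+ : ∀ m n → odd (m + n) ≡ odd m xor odd n
odd-+ zero    n = refl
odd-+ (suc m) n = trans (cong not (odd-+ m n)) (not-distribˡ-xor (odd m) (odd n))

odd-* : ∀ m n → odd (m * n) ≡ odd m ∧ odd n
odd-* zero    n = refl
odd-* (suc m) n = begin
  odd (n + m * n)              ≡⟨ odd-+ n (m * n) ⟩
  odd n xor odd (m * n)        ≡⟨ cong (odd n xor_) (odd-* m n) ⟩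
  odd n xor (odd m ∧ odd n)    ≡⟨ absorb (odd m) (odd n) ⟩
  not (odd m) ∧ odd n          ∎
  where
  absorb : ∀ a b → b xor (a ∧ b) ≡ (true xor a) ∧ b
  absorb = solve-∀ xorRing

odd-2* : ∀ n → odd (2 * n) ≡ false
odd-2* n = odd-* 2 n

odd-*-oddʳ : ∀ a {b} → odd b ≡ true → odd (a * b) ≡ odd a
odd-*-oddʳ a {b} b-odd = trans (odd-* a b) (trans (cong (odd a ∧_) b-odd) (∧-identityʳ (odd a)))

odd⇒nonZero : ∀ {q} → odd q ≡ true → NonZero q
odd⇒nonZero {suc q} _ = _

even⇒2* : ∀ {m} → odd m ≡ false → ∃[ h ] m ≡ 2 * h
even⇒2* {zero}        _    = 0 , refl
even⇒2* {suc zero}    ()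
even⇒2* {suc (suc m)} even with even⇒2* {m} (trans (sym (not-involutive (odd m))) even)
... | h , refl = suc h , cong suc (sym (+-suc h (h + 0)))

even⇒2≤ : ∀ {t} → odd t ≡ false → 0 < t → 2 ≤ t
even⇒2≤ {suc (suc t)} _ _ = s≤s (s≤s z≤n)

even<2*⇒suc< : ∀ {t h} → odd t ≡ false → t < 2 * h → suc t < 2 * h
even<2*⇒suc< {t} {h} t-even t<2h =
  ≤∧≢⇒< t<2h λ eq → contradiction (trans (sym (cong not t-even)) (trans (cong odd eq) (odd-2* h))) λ ()

2∣⇒even : ∀ {m} → 2 ∣ m → odd m ≡ false
2∣⇒even (divides q refl) = trans (odd-* q 2) (∧-zeroʳ (odd q))

odd-quotient : ∀ {r a k} → odd a ≡ true → r * a ≡ 2 * k → ∃[ h ] r ≡ 2 * h × k ≡ h * a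
odd-quotient {r} {a} {k} a-odd eq = halve (even⇒2* r-even)
  where
  r-even : odd r ≡ false
  r-even = trans (sym (odd-*-oddʳ r {a} a-odd)) (trans (cong odd eq) (odd-2* k))
  halve : ∃[ h ] r ≡ 2 * h → ∃[ h ] r ≡ 2 * h × k ≡ h * a
  halve (h , r≡2h) = h , r≡2h , *-cancelˡ-≡ k (h * a) 2 (trans (sym eq) (trans (cong (_* a) r≡2h) (*-assoc 2 h a)))

positive-odd-quotient : ∀ {r a k} → 0 < r → odd a ≡ true → r * a ≡ 2 * k →
                        ∃[ h ] r ≡ 2 * suc h × k ≡ suc h * a
positive-odd-quotient {r} {a} {k} 0<r a-odd eq = positive (odd-quotient a-odd eq)
  where
  positive : ∃[ h ] r ≡ 2 * h × k ≡ h * a → ∃[ h ] r ≡ 2 * suc h × k ≡ suc h * a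
  positive (zero  , r≡0 , _) = contradiction (subst (0 <_) r≡0 0<r) (n≮n 0)
  positive (suc h , r≡ , k≡) = h , r≡ , k≡

odd-∣2*⇒∣ : ∀ {h t} → odd h ≡ true → h ∣ 2 * t → h ∣ t
odd-∣2*⇒∣ {h} {t} h-odd (divides c eq) = let c′ , _ , t≡ = odd-quotient {c} {h} {t} h-odd (sym eq) in divides c′ t≡

odd∤even : ∀ {h t} → odd h ≡ true → odd t ≡ false → 0 < t → t < 2 * h → ¬ h ∣ t
odd∤even {h} {t} h-odd t-even 0<t t<2h h∣t with even⇒2* {t} t-even
... | u , refl = <⇒≱ t<2h (*-monoʳ-≤ 2 (∣⇒≤ {{>-nonZero (*-cancelˡ-< 2 0 u 0<t)}} (odd-∣2*⇒∣ h-odd h∣t)))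

2*suc∸2 : ∀ k → 2 * suc k ∸ 2 ≡ 2 * k
2*suc∸2 k = cong (_∸ 2) (*-suc 2 k)

module _ {k : ℕ} where
  private
    instance
      gcd≢0 : NonZero (gcd 2 (suc k))
      gcd≢0 = ≢-nonZero (gcd[m,n]≢0 2 (suc k) (inj₁ (λ ())))

  cycleLen-odd : odd k ≡ true → cycleLen (suc k) ≡ k
  cycleLen-odd k-odd with even⇒2* {suc k} (cong not k-odd)
  ... | h , eq = begin
    (2 * suc k ∸ 2) / gcd 2 (suc k)  ≡⟨ /-congʳ gcd≡2 ⟩
    (2 * suc k ∸ 2) / 2              ≡⟨ /-congˡ (trans (2*suc∸2 k) (*-comm 2 k)) ⟩
    k * 2 / 2                        ≡⟨ m*n/n≡m k 2 ⟩
    k                                ∎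
    where
    gcd≡2 : gcd 2 (suc k) ≡ 2
    gcd≡2 = ∣-antisym (gcd[m,n]∣m 2 (suc k)) (gcd-greatest ∣-refl (divides h (trans eq (*-comm 2 h))))

  cycleLen-even : odd k ≡ false → cycleLen (suc k) ≡ 2 * k
  cycleLen-even k-even = begin
    (2 * suc k ∸ 2) / gcd 2 (suc k)  ≡⟨ /-congʳ gcd≡1 ⟩
    (2 * suc k ∸ 2) / 1              ≡⟨ n/1≡n _ ⟩
    2 * suc k ∸ 2                    ≡⟨ 2*suc∸2 k ⟩
    2 * k                            ∎
    where
    gcd≡1 : gcd 2 (suc k) ≡ 1
    gcd≡1 with prime⇒irreducible prime[2] (gcd[m,n]∣m 2 (suc k))
    ... | inj₁ g≡1 = g≡1
    ... | inj₂ g≡2 =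
      contradiction (trans (sym (cong not k-even)) (2∣⇒even (subst (_∣ suc k) g≡2 (gcd[m,n]∣n 2 (suc k))))) λ ()

∣cycleLen⇒ : ∀ {k r} → 0 < r → r ∣ cycleLen (suc k) → ¬ r ∣ k →
             odd k ≡ false × ∃[ h ] ∃[ q ] r ≡ 2 * suc h × k ≡ suc h * q × odd q ≡ true
∣cycleLen⇒ {k} {r} 0<r r∣cycle r∤k with odd k in k-parity
... | true  = contradiction (subst (r ∣_) (cycleLen-odd {k} k-parity) r∣cycle) r∤k
... | false with subst (r ∣_) (cycleLen-even {k} k-parity) r∣cycle
...   | divides a 2k≡ar with odd a in a-parity
...     | true  = let h , r≡ , k≡ = positive-odd-quotient {r} {a} {k} 0<r a-parity (trans (*-comm r a) (sym 2k≡ar))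
                  in refl , h , a , r≡ , k≡ , a-parity
...     | false = let a′ , a≡ = even⇒2* {a} a-parity
                  in contradiction (divides a′ (*-cancelˡ-≡ k (a′ * r) 2
                                                  (trans 2k≡ar (trans (cong (_* r) a≡) (*-assoc 2 a′ r))))) r∤k

block : (h : ℕ) .{{_ : NonZero h}} → ℕ → Bool
block h m = odd (m / h)

module _ {h : ℕ} .{{_ : NonZero h}} where

  block-+* : ∀ m q → block h (m + q * h) ≡ block h m xor odd q
  block-+* m q = begin
    odd ((m + q * h) / h)    ≡⟨ cong odd (+-distrib-/-∣ʳ m (divides q refl)) ⟩
    odd (m / h + q * h / h)  ≡⟨ cong (λ x → odd (m / h + x)) (m*n/n≡m q h) ⟩
    odd (m / h + q)          ≡⟨ odd-+ (m / h) q ⟩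
    block h m xor odd q      ∎

  block-< : ∀ {m} → m < h → block h m ≡ false
  block-< m<h = cong odd (m<n⇒m/n≡0 m<h)

  block-≥ : ∀ {m} → h ≤ m → m < 2 * h → block h m ≡ true
  block-≥ {m} h≤m m<2h = begin
    block h m                        ≡⟨ cong (block h) m≡ ⟨
    block h ((m ∸ h) + 1 * h)        ≡⟨ block-+* (m ∸ h) 1 ⟩
    block h (m ∸ h) xor true         ≡⟨ cong (_xor true) (block-< (m<n+o⇒m∸n<o m h m<h+h)) ⟩
    true                             ∎
    where
    m<h+h : m < h + h
    m<h+h = subst (m <_) (cong (h +_) (+-identityʳ h)) m<2h
    m≡ : (m ∸ h) + 1 * h ≡ m
    m≡ = trans (cong ((m ∸ h) +_) (*-identityˡ h)) (m∸n+n≡m h≤m)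

  block-2*-periodic : ∀ j → block h (2 * h + j) ≡ block h j
  block-2*-periodic j = trans (cong (block h) (+-comm (2 * h) j)) (trans (block-+* j 2) (xor-identityʳ (block h j)))

  h<2*h : h < 2 * h
  h<2*h = subst (h <_) (*-comm h 2) (m<m*n h 2 (s≤s (s≤s z≤n)))

  block-window : ∀ {t} → 0 < t → t < 2 * h → ∃[ j ] j < h × block h j ≡ false × block h (t + j) ≡ true
  block-window {t} 0<t t<2h with t <? h
  ... | yes t<h = h ∸ t , h∸t<h , block-< h∸t<h , trans (cong (block h) (m+[n∸m]≡n (<⇒≤ t<h))) (block-≥ ≤-refl h<2*h)
    where
    h∸t<h : h ∸ t < h
    h∸t<h = ∸-monoʳ-< 0<t (<⇒≤ t<h)
  ... | no t≮h = 0 , 0<h , block-< 0<h , trans (cong (block h) (+-identityʳ t)) (block-≥ (≮⇒≥ t≮h) t<2h)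
    where
    0<h : 0 < h
    0<h = >-nonZero⁻¹ h

  block-window-pair : ∀ {t} → 2 ≤ t → suc t < 2 * h →
                  ∃[ j ] suc j < h × block h j ≡ false × block h (suc j) ≡ false ×
                         block h (t + j) ≡ true × block h (t + suc j) ≡ true
  block-window-pair {t} 2≤t 1+t<2h with t <? h
  ... | yes t<h = j , 1+j<h , block-< (<-trans (n<1+n j) 1+j<h) , block-< 1+j<h ,
                  trans (cong (block h) t+j≡h) (block-≥ ≤-refl h<2*h) ,
                  trans (cong (block h) (trans (+-suc t j) (cong suc t+j≡h))) (block-≥ (n≤1+n h) 1+h<2h)
    where
    j = h ∸ t
    t+j≡h : t + j ≡ h
    t+j≡h = m+[n∸m]≡n (<⇒≤ t<h)
    1+j<h : suc j < h
    1+j<h = subst (2 + j ≤_) t+j≡h (+-monoˡ-≤ j 2≤t)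
    1+h<2h : suc h < 2 * h
    1+h<2h = subst (suc h <_) (cong (h +_) (sym (+-identityʳ h))) (+-monoˡ-< h (<-trans 2≤t t<h))
  ... | no t≮h = 0 , 1<h , block-< (<-trans z<s 1<h) , block-< 1<h ,
                 trans (cong (block h) (+-identityʳ t)) (block-≥ h≤t (<-trans (n<1+n t) 1+t<2h)) ,
                 trans (cong (block h) (+-comm t 1)) (block-≥ (≤-trans h≤t (n≤1+n t)) 1+t<2h)
    where
    h≤t : h ≤ t
    h≤t = ≮⇒≥ t≮h
    1<h : 1 < h
    1<h = ≰⇒> λ h≤1 → <⇒≱ 1+t<2h (≤-trans (*-monoʳ-≤ 2 h≤1) (≤-trans 2≤t (n≤1+n t)))

  block-window-parity : ∀ {t} → 2 ≤ t → suc t < 2 * h → ∀ e →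
                        ∃[ j ] j < h × odd j ≡ e × block h j ≡ false × block h (t + j) ≡ true
  block-window-parity {t} 2≤t 1+t<2h e with block-window-pair 2≤t 1+t<2h
  ... | j , 1+j<h , bj , b1+j , btj , bt1+j with odd j ≟ᵇ e
  ...   | yes oj≡e = j , <-trans (n<1+n j) 1+j<h , oj≡e , bj , btj
  ...   | no  oj≢e = suc j , 1+j<h , sym (¬-not (oj≢e ∘ sym)) , b1+j , bt1+j

infix 5 _∣ᵇ_

_∣ᵇ_ : ℕ → ℕ → Bool
h ∣ᵇ m = does (h ∣? m)

∣ᵇ-+ : ∀ {h k} m → h ∣ k → h ∣ᵇ m + k ≡ h ∣ᵇ m
∣ᵇ-+ {h} {k} m h∣k with h ∣? m
... | yes h∣m = dec-true (h ∣? (m + k)) (∣m∣n⇒∣m+n h∣m h∣k)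
... | no ¬h∣m = dec-false (h ∣? (m + k)) (¬h∣m ∘ λ h∣m+k → ∣m+n∣m⇒∣n (subst (h ∣_) (+-comm m k) h∣m+k) h∣k)

∣ᵇ-0 : ∀ h → h ∣ᵇ 0 ≡ true
∣ᵇ-0 h = dec-true (h ∣? 0) (h ∣0)

∤⇒∣ᵇ≡false : ∀ {h m} → ¬ h ∣ m → h ∣ᵇ m ≡ false
∤⇒∣ᵇ≡false {h} {m} = dec-false (h ∣? m)

module _ {k : ℕ} where

  _agreesWith_ : State (suc k) → (ℕ → Bool) → Set
  x agreesWith X = ∀ i → x i ≡ X (toℕ i)

  opaque
    extend : State (suc k) → ℕ → Bool
    extend x j with j <? suc k
    ... | yes j<n = x (fromℕ< j<n)
    ... | no  _   = false

    agreesWith-extend : (x : State (suc k)) → x agreesWith extend x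
    agreesWith-extend x i with toℕ i <? suc k
    ... | yes i<n = cong x (sym (fromℕ<-toℕ i i<n))
    ... | no  i≮n = contradiction (toℕ<n i) i≮n

  ≡-on-Fin⇒≡-on-≤ : ∀ {X Y : ℕ → Bool} → (∀ (i : Fin (suc k)) → X (toℕ i) ≡ Y (toℕ i)) →
                     ∀ j → j ≤ k → X j ≡ Y j
  ≡-on-Fin⇒≡-on-≤ {X} {Y} eq j j≤k = subst (λ j → X j ≡ Y j) (toℕ-fromℕ< (s≤s j≤k)) (eq (fromℕ< (s≤s j≤k)))

  toℕ-prevC-zero : ∀ {i : Fin (suc k)} → toℕ i ≡ 0 → toℕ (prevC i) ≡ k
  toℕ-prevC-zero {i} i≡0 = begin
    toℕ (prevC i)        ≡⟨ toℕ-fromℕ< _ ⟩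
    (toℕ i + k) % suc k  ≡⟨ cong (λ z → (z + k) % suc k) i≡0 ⟩
    k % suc k            ≡⟨ m<n⇒m%n≡m (n<1+n k) ⟩
    k                    ∎

  toℕ-prevC-suc : ∀ {i : Fin (suc k)} {j} → toℕ i ≡ suc j → toℕ (prevC i) ≡ j
  toℕ-prevC-suc {i} {j} i≡1+j = begin
    toℕ (prevC i)        ≡⟨ toℕ-fromℕ< _ ⟩
    (toℕ i + k) % suc k  ≡⟨ cong (λ z → (z + k) % suc k) i≡1+j ⟩
    (suc j + k) % suc k  ≡⟨ cong (_% suc k) (+-suc j k) ⟨
    (j + suc k) % suc k  ≡⟨ [m+n]%n≡m%n j (suc k) ⟩
    j % suc k            ≡⟨ m<n⇒m%n≡m j<1+k ⟩
    j                    ∎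
    where
    j<1+k : j < suc k
    j<1+k = <-trans (n<1+n j) (subst (_< suc k) i≡1+j (toℕ<n i))

  toℕ-nextC : ∀ {i : Fin (suc k)} → toℕ i < k → toℕ (nextC i) ≡ suc (toℕ i)
  toℕ-nextC {i} i<k = trans (toℕ-fromℕ< _) $ trans (cong (_% suc k) (+-comm (toℕ i) 1)) (m<n⇒m%n≡m (s≤s i<k))

  toℕ-nextC-last : ∀ {i : Fin (suc k)} → toℕ i ≡ k → toℕ (nextC i) ≡ 0
  toℕ-nextC-last {i} i≡k =
    trans (toℕ-fromℕ< _) $ trans (cong (_% suc k) (trans (+-comm (toℕ i) 1) (cong suc i≡k))) (n%n≡0 (suc k))

module Sweep {k : ℕ} (f : Fin (suc k) → Bool) where

  c : ℕ → Bool
  c = extend f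

  D : ℕ → Bool
  D zero    = c 0
  D (suc j) = D j xor c (suc j)

  -- sweep X (suc j) is the value written at vertex j when the old state is X;
  -- sweep X 0 is the old value at vertex k, the left neighbour of vertex 0.
  sweep : (ℕ → Bool) → ℕ → Bool
  sweep X zero    = X k
  sweep X (suc j) = localFun (c j) (sweep X j) (X j) (X (suc j))

  sweep-closed : ∀ X j → sweep X (suc j) ≡ X 0 xor X k xor X (suc j) xor D j
  sweep-closed X zero    = rearrange (c 0) (X k) (X 0) (X 1)
    where
    rearrange : ∀ c a b d → c xor (a xor (b xor d)) ≡ b xor a xor d xor c
    rearrange = solve-∀ xorRing
  sweep-closed X (suc j) = begin
    c (suc j) xor (sweep X (suc j) xor (X (suc j) xor X (suc (suc j))))
      ≡⟨ cong (λ s → c (suc j) xor (s xor (X (suc j) xor X (suc (suc j))))) (sweep-closed X j) ⟩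
    c (suc j) xor ((X 0 xor X k xor X (suc j) xor D j) xor (X (suc j) xor X (suc (suc j))))
      ≡⟨ telescope (c (suc j)) (X 0) (X k) (X (suc j)) (X (suc (suc j))) (D j) ⟩
    X 0 xor X k xor X (suc (suc j)) xor D (suc j)
      ∎
    where
    telescope : ∀ c a b d e s → c xor ((a xor b xor d xor s) xor (d xor e)) ≡ a xor b xor e xor (s xor c)
    telescope = solve-∀ xorRing

  applyUpTo-untouched : ∀ m x (i : Fin (suc k)) → m ≤ toℕ i → applyUpTo f m x i ≡ x i
  applyUpTo-untouched zero    x i _ = refl
  applyUpTo-untouched (suc m) x i m<i with m <? suc k
  ... | no _ = applyUpTo-untouched m x i (<⇒≤ m<i)
  ... | yes m<n with i ≟ fromℕ< m<n
  ...   | yes refl = contradiction (subst (m <_) (toℕ-fromℕ< m<n) m<i) (n≮n m)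
  ...   | no _     = applyUpTo-untouched m x i (<⇒≤ m<i)

  applyUpTo-sweep : ∀ m {x X} → m ≤ k → x agreesWith X →
                    ∀ i → toℕ i < m → applyUpTo f m x i ≡ sweep X (suc (toℕ i))
  applyUpTo-prevC : ∀ m {x X} → m ≤ k → x agreesWith X →
                    ∀ i → toℕ i ≡ m → applyUpTo f m x (prevC i) ≡ sweep X m

  applyUpTo-sweep (suc m) {x} {X} m<k x≈X i i<1+m with m <? suc k
  ... | no m≮n = contradiction (m<n⇒m<1+n m<k) m≮n
  ... | yes m<n with i ≟ fromℕ< m<n
  ...   | no i≢m =
    applyUpTo-sweep m (<⇒≤ m<k) x≈X i (≤∧≢⇒< (s≤s⁻¹ i<1+m) (i≢m ∘ toℕ-injective ∘ (λ e → trans e (sym i≡m))))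
    where
    i≡m : toℕ (fromℕ< m<n) ≡ m
    i≡m = toℕ-fromℕ< m<n
  ...   | yes refl = begin
    localFun (f i) (y (prevC i)) (y i) (y (nextC i))
      ≡⟨ cong₂ (λ a b → localFun a b (y i) (y (nextC i))) (trans (agreesWith-extend f i) (cong c i≡m))
                                                          (applyUpTo-prevC m (<⇒≤ m<k) x≈X i i≡m) ⟩
    localFun (c m) (sweep X m) (y i) (y (nextC i))
      ≡⟨ cong₂ (localFun (c m) (sweep X m)) (trans (untouched i (≤-reflexive (sym i≡m))) (cong X i≡m))
                                           (trans (untouched (nextC i) (≤-trans (n≤1+n m) next≥)) (cong X next≡)) ⟩
    sweep X (suc m)
      ≡⟨ cong (sweep X ∘ suc) i≡m ⟨
    sweep X (suc (toℕ i))
      ∎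
    where
    y : State (suc k)
    y = applyUpTo f m x
    i≡m : toℕ i ≡ m
    i≡m = toℕ-fromℕ< m<n
    next≡ : toℕ (nextC i) ≡ suc m
    next≡ = trans (toℕ-nextC (subst (_< k) (sym i≡m) m<k)) (cong suc i≡m)
    next≥ : suc m ≤ toℕ (nextC i)
    next≥ = ≤-reflexive (sym next≡)
    untouched : ∀ j → m ≤ toℕ j → y j ≡ X (toℕ j)
    untouched j m≤j = trans (applyUpTo-untouched m x j m≤j) (x≈X j)

  applyUpTo-prevC zero    {X = X} _   x≈X i i≡0 = trans (x≈X (prevC i)) (cong X (toℕ-prevC-zero i≡0))
  applyUpTo-prevC (suc m) {X = X} m<k x≈X i i≡1+m =
    trans (applyUpTo-sweep (suc m) m<k x≈X (prevC i) (≤-reflexive (cong suc (toℕ-prevC-suc i≡1+m))))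
          (cong (sweep X ∘ suc) (toℕ-prevC-suc i≡1+m))

module _ {k₁ : ℕ} (f : Fin (suc (suc k₁)) → Bool) where
  open Sweep f

  private
    k : ℕ
    k = suc k₁

  sdsMap-< : ∀ {x X} → x agreesWith X → ∀ i → toℕ i < k →
             sdsMap f x i ≡ X 0 xor X k xor X (suc (toℕ i)) xor D (toℕ i)
  sdsMap-< {x} {X} x≈X i i<k with k <? suc k
  ... | no k≮n = contradiction (n<1+n k) k≮n
  ... | yes k<n with i ≟ fromℕ< k<n
  ...   | yes refl = contradiction (subst (_< k) (toℕ-fromℕ< k<n) i<k) (n≮n k)
  ...   | no _     = trans (applyUpTo-sweep k ≤-refl x≈X i i<k) (sweep-closed X (toℕ i))

  sdsMap-last : ∀ {x X} → x agreesWith X → ∀ i → toℕ i ≡ k → sdsMap f x i ≡ X 1 xor D k xor c 0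
  sdsMap-last {x} {X} x≈X i i≡k with k <? suc k
  ... | no k≮n = contradiction (n<1+n k) k≮n
  ... | yes k<n with i ≟ fromℕ< k<n
  ...   | no i≢k   = contradiction (toℕ-injective (trans i≡k (sym (toℕ-fromℕ< k<n)))) i≢k
  ...   | yes refl = begin
    localFun (f i) (y (prevC i)) (y i) (y (nextC i))
      ≡⟨ cong₂ (λ a b → localFun a b (y i) (y (nextC i))) (trans (agreesWith-extend f i) (cong c i≡k))
                                                          (applyUpTo-prevC k ≤-refl x≈X i i≡k) ⟩
    localFun (c k) (sweep X k) (y i) (y (nextC i))
      ≡⟨ cong₂ (localFun (c k) (sweep X k))
               (trans (applyUpTo-untouched k x i (≤-reflexive (sym i≡k))) (trans (x≈X i) (cong X i≡k)))
               (trans (applyUpTo-sweep k ≤-refl x≈X (nextC i) (subst (_< k) (sym next≡0) z<s))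
                      (cong (sweep X ∘ suc) next≡0)) ⟩
    localFun (c k) (sweep X k) (X k) (sweep X 1)
      ≡⟨ cong₂ (λ a b → localFun (c k) a (X k) b) (sweep-closed X k₁) (sweep-closed X 0) ⟩
    c k xor ((X 0 xor X k xor X k xor D k₁) xor (X k xor (X 0 xor X k xor X 1 xor c 0)))
      ≡⟨ rearrange (c k) (X 0) (X k) (X 1) (D k₁) (c 0) ⟩
    X 1 xor D k xor c 0
      ∎
    where
    y : State (suc k)
    y = applyUpTo f k x
    next≡0 : toℕ (nextC i) ≡ 0
    next≡0 = toℕ-nextC-last i≡k
    rearrange : ∀ e a b d s c → e xor ((a xor b xor b xor s) xor (b xor (a xor b xor d xor c))) ≡ d xor (s xor e) xor c
    rearrange = solve-∀ xorRing

module Orbits {k₂ : ℕ} (f : Fin (suc (suc (suc k₂))) → Bool) where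
  open Sweep f

  k₁ k : ℕ
  k₁ = suc k₂
  k  = suc k₁

  T : State (suc k) → State (suc k)
  T = sdsMap f

  C : Bool
  C = D k

  P : ℕ → Bool
  P zero    = false
  P (suc j) = P j xor D j xor (odd j ∧ C)

  K : Bool
  K = D k₁ xor P k₁

  -- T adds C to x₀ + x_k; along the orbit of `point s w` this sum is `phase s t`.
  phase : Bool → ℕ → Bool
  phase s t = s xor (odd t ∧ C)

  twist : Bool → ℕ → Bool
  twist s m = K xor (odd k₁ ∧ phase s (suc m))

  Twisted : Bool → (ℕ → Bool) → Set
  Twisted s w = ∀ m → w (m + k) ≡ w m xor twist s m

  -- orbitSeq s w t is the state reached from `point s w` after t steps (iter-point).
  orbitSeq : Bool → (ℕ → Bool) → ℕ → ℕ → Bool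
  orbitSeq s w t j = if does (j <? k) then w (t + j) xor P j xor (odd j ∧ phase s t) else w t xor phase s t

  point : Bool → (ℕ → Bool) → State (suc k)
  point s w i = orbitSeq s w 0 (toℕ i)

  phase-0 : ∀ {s} → phase s 0 ≡ s
  phase-0 {s} = xor-identityʳ s

  phase-const : ∀ {s} → C ≡ false → ∀ t → phase s t ≡ s
  phase-const {s} C≡false t = begin
    s xor (odd t ∧ C)      ≡⟨ cong (λ b → s xor (odd t ∧ b)) C≡false ⟩
    s xor (odd t ∧ false)  ≡⟨ cong (s xor_) (∧-zeroʳ (odd t)) ⟩
    s xor false            ≡⟨ xor-identityʳ s ⟩
    s                      ∎

  phase-even : ∀ {s} h → phase s (2 * h) ≡ s
  phase-even {s} h = trans (cong (λ o → s xor (o ∧ C)) (odd-2* h)) (xor-identityʳ s)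

  phase-period⇒even : ∀ {s t} → C ≡ true → phase s t ≡ s → odd t ≡ false
  phase-period⇒even {s} {t} C≡true phase≡ = begin
    odd t            ≡⟨ ∧-identityʳ (odd t) ⟨
    odd t ∧ true     ≡⟨ cong (odd t ∧_) C≡true ⟨
    odd t ∧ C        ≡⟨ xor-cancelˡ s (trans phase≡ (sym (xor-identityʳ s))) ⟩
    false            ∎

  twist-C≡false : ∀ {s} → C ≡ false → ∀ m → twist s m ≡ K xor (odd k₁ ∧ s)
  twist-C≡false C≡false m = cong (λ a → K xor (odd k₁ ∧ a)) (phase-const C≡false (suc m))

  twist-k-odd : ∀ {s} → odd k₁ ≡ false → ∀ m → twist s m ≡ K
  twist-k-odd {s} k₁-even m = trans (cong (λ o → K xor (o ∧ phase s (suc m))) k₁-even) (xor-identityʳ K)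

  twist-alternating : ∀ {s} → odd k₁ ≡ true → C ≡ true → ∀ m → twist s m ≡ (K xor not s) xor odd m
  twist-alternating {s} k₁-odd C≡true m = begin
    K xor (odd k₁ ∧ (s xor (not (odd m) ∧ C)))
      ≡⟨ cong₂ (λ o c → K xor (o ∧ (s xor (not (odd m) ∧ c)))) k₁-odd C≡true ⟩
    K xor (true ∧ (s xor ((true xor odd m) ∧ true))) ≡⟨ alternate K s (odd m) ⟩
    (K xor not s) xor odd m                       ∎
    where
    alternate : ∀ a s o → a xor (true ∧ (s xor ((true xor o) ∧ true))) ≡ (a xor (true xor s)) xor o
    alternate = solve-∀ xorRing

  module _ {s : Bool} {w : ℕ → Bool} where

    orbitSeq-< : ∀ {t j} → j < k → orbitSeq s w t j ≡ w (t + j) xor P j xor (odd j ∧ phase s t)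
    orbitSeq-< {j = j} j<k rewrite dec-true (j <? k) j<k = refl

    orbitSeq-last : ∀ {t} → orbitSeq s w t k ≡ w t xor phase s t
    orbitSeq-last rewrite dec-false (k <? k) (n≮n k) = refl

    orbitSeq-0 : ∀ {t} → orbitSeq s w t 0 ≡ w t
    orbitSeq-0 {t} = trans (orbitSeq-< z<s) (trans (cong (λ m → w m xor false xor false) (+-identityʳ t)) (units (w t)))
      where
      units : ∀ a → a xor false xor false ≡ a
      units = solve-∀ xorRing

    orbitSeq-step-< : ∀ {t j} → suc j < k →
                      orbitSeq s w t 0 xor orbitSeq s w t k xor orbitSeq s w t (suc j) xor D j ≡ orbitSeq s w (suc t) j
    orbitSeq-step-< {t} {j} 1+j<k = begin
      orbitSeq s w t 0 xor orbitSeq s w t k xor orbitSeq s w t (suc j) xor D j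
        ≡⟨ cong₂ (λ a b → a xor b xor orbitSeq s w t (suc j) xor D j) orbitSeq-0 orbitSeq-last ⟩
      w t xor (w t xor phase s t) xor orbitSeq s w t (suc j) xor D j
        ≡⟨ cong (λ a → w t xor (w t xor phase s t) xor a xor D j)
                (trans (orbitSeq-< 1+j<k) (cong (λ m → w m xor P (suc j) xor (odd (suc j) ∧ phase s t)) (+-suc t j))) ⟩
      w t xor (w t xor phase s t) xor (w (suc t + j) xor P (suc j) xor (odd (suc j) ∧ phase s t)) xor D j
        ≡⟨ recombine (w t) (w (suc t + j)) (P j) (D j) (odd j) (odd t) s C ⟩
      w (suc t + j) xor P j xor (odd j ∧ phase s (suc t))
        ≡⟨ orbitSeq-< (<-trans (n<1+n j) 1+j<k) ⟨
      orbitSeq s w (suc t) j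
        ∎
      where
      recombine : ∀ a b p d o q s C →
              a xor (a xor (s xor (q ∧ C))) xor (b xor (p xor d xor (o ∧ C)) xor ((true xor o) ∧ (s xor (q ∧ C)))) xor d
              ≡ b xor p xor (o ∧ (s xor ((true xor q) ∧ C)))
      recombine = solve-∀ xorRing

    orbitSeq-step-k₁ : ∀ {t} → Twisted s w →
                       orbitSeq s w t 0 xor orbitSeq s w t k xor orbitSeq s w t k xor D k₁ ≡ orbitSeq s w (suc t) k₁
    orbitSeq-step-k₁ {t} twisted = begin
      orbitSeq s w t 0 xor orbitSeq s w t k xor orbitSeq s w t k xor D k₁
        ≡⟨ cong₂ (λ a b → a xor b xor b xor D k₁) orbitSeq-0 orbitSeq-last ⟩
      w t xor (w t xor phase s t) xor (w t xor phase s t) xor D k₁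
        ≡⟨ unwind (w t) (phase s t) (D k₁) (P k₁) (odd k₁ ∧ phase s (suc t)) ⟩
      (w t xor twist s t) xor P k₁ xor (odd k₁ ∧ phase s (suc t))
        ≡⟨ cong (λ a → a xor P k₁ xor (odd k₁ ∧ phase s (suc t))) (trans (cong w (sym (+-suc t k₁))) (twisted t)) ⟨
      w (suc t + k₁) xor P k₁ xor (odd k₁ ∧ phase s (suc t))
        ≡⟨ orbitSeq-< (n<1+n k₁) ⟨
      orbitSeq s w (suc t) k₁
        ∎
      where
      unwind : ∀ a p d q e → a xor (a xor p) xor (a xor p) xor d ≡ (a xor ((d xor q) xor e)) xor q xor e
      unwind = solve-∀ xorRing

    orbitSeq-step-last : ∀ {t} → orbitSeq s w t 1 xor D k xor c 0 ≡ orbitSeq s w (suc t) k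
    orbitSeq-step-last {t} = begin
      orbitSeq s w t 1 xor C xor c 0
        ≡⟨ cong (λ a → a xor C xor c 0)
                (trans (orbitSeq-< (s≤s z<s)) (cong (λ m → w m xor P 1 xor (odd 1 ∧ phase s t)) (+-comm t 1))) ⟩
      (w (suc t) xor (false xor c 0 xor false) xor (true ∧ phase s t)) xor C xor c 0
        ≡⟨ advance (w (suc t)) (c 0) s (odd t) C ⟩
      w (suc t) xor phase s (suc t)
        ≡⟨ orbitSeq-last ⟨
      orbitSeq s w (suc t) k
        ∎
      where
      advance : ∀ a c s q C → (a xor (false xor c xor false) xor (true ∧ (s xor (q ∧ C)))) xor C xor c
                              ≡ a xor (s xor ((true xor q) ∧ C))
      advance = solve-∀ xorRing

    T-orbitSeq : ∀ {x t} → Twisted s w → x agreesWith orbitSeq s w t → T x agreesWith orbitSeq s w (suc t)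
    T-orbitSeq {x} {t} twisted x≈ i with <-cmp (toℕ i) k₁
    ... | tri< i<k₁ _ _ = trans (sdsMap-< f {X = orbitSeq s w t} x≈ i (m<n⇒m<1+n i<k₁)) (orbitSeq-step-< (s≤s i<k₁))
    ... | tri≈ _ i≡k₁ _ = begin
      T x i
        ≡⟨ sdsMap-< f {X = orbitSeq s w t} x≈ i (subst (_< k) (sym i≡k₁) (n<1+n k₁)) ⟩
      X 0 xor X k xor X (suc (toℕ i)) xor D (toℕ i)
        ≡⟨ cong (λ j → X 0 xor X k xor X (suc j) xor D j) i≡k₁ ⟩
      X 0 xor X k xor X k xor D k₁
        ≡⟨ orbitSeq-step-k₁ twisted ⟩
      orbitSeq s w (suc t) k₁
        ≡⟨ cong (orbitSeq s w (suc t)) i≡k₁ ⟨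
      orbitSeq s w (suc t) (toℕ i)
        ∎
      where
      X : ℕ → Bool
      X = orbitSeq s w t
    ... | tri> _ _ i>k₁ =
      trans (sdsMap-last f {X = orbitSeq s w t} x≈ i i≡k) (trans orbitSeq-step-last (cong (orbitSeq s w (suc t)) (sym i≡k)))
      where
      i≡k : toℕ i ≡ k
      i≡k = ≤-antisym (s≤s⁻¹ (toℕ<n i)) i>k₁

    iter-point : Twisted s w → ∀ t → iter t T (point s w) agreesWith orbitSeq s w t
    iter-point twisted zero    i = refl
    iter-point twisted (suc t)   = T-orbitSeq twisted (iter-point twisted t)

  orbitSeq-cong : ∀ {s s′ w w′ t t′} → phase s t ≡ phase s′ t′ → (∀ j → j < k → w (t + j) ≡ w′ (t′ + j)) →
                  ∀ j → j ≤ k → orbitSeq s w t j ≡ orbitSeq s′ w′ t′ j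
  orbitSeq-cong {s} {s′} {w} {w′} {t} {t′} phase≡ w≡ j j≤k with j <? k
  ... | yes j<k = begin
    orbitSeq s w t j                               ≡⟨ orbitSeq-< {s} {w} j<k ⟩
    w (t + j) xor P j xor (odd j ∧ phase s t)      ≡⟨ cong₂ (λ a b → a xor P j xor (odd j ∧ b)) (w≡ j j<k) phase≡ ⟩
    w′ (t′ + j) xor P j xor (odd j ∧ phase s′ t′)  ≡⟨ orbitSeq-< {s′} {w′} j<k ⟨
    orbitSeq s′ w′ t′ j                            ∎
  ... | no j≮k rewrite ≤-antisym j≤k (≮⇒≥ j≮k) = begin
    orbitSeq s w t k        ≡⟨ orbitSeq-last {s} {w} ⟩
    w t xor phase s t       ≡⟨ cong₂ _xor_ w-t≡ phase≡ ⟩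
    w′ t′ xor phase s′ t′   ≡⟨ orbitSeq-last {s′} {w′} ⟨
    orbitSeq s′ w′ t′ k     ∎
    where
    w-t≡ : w t ≡ w′ t′
    w-t≡ = trans (cong w (sym (+-identityʳ t))) (trans (w≡ 0 z<s) (cong w′ (+-identityʳ t′)))

  orbitSeq-cancel : ∀ {s s′ w w′ t t′} → (∀ j → j ≤ k → orbitSeq s w t j ≡ orbitSeq s′ w′ t′ j) →
                    phase s t ≡ phase s′ t′ × (∀ j → j < k → w (t + j) ≡ w′ (t′ + j))
  orbitSeq-cancel {s} {s′} {w} {w′} {t} {t′} eq = phase≡ , w≡
    where
    w-t≡ : w t ≡ w′ t′
    w-t≡ = trans (sym (orbitSeq-0 {s} {w})) (trans (eq 0 z≤n) (orbitSeq-0 {s′} {w′}))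
    phase≡ : phase s t ≡ phase s′ t′
    phase≡ = xor-cancelˡ (w t) (begin
      w t xor phase s t     ≡⟨ orbitSeq-last {s} {w} ⟨
      orbitSeq s w t k      ≡⟨ eq k ≤-refl ⟩
      orbitSeq s′ w′ t′ k   ≡⟨ orbitSeq-last {s′} {w′} ⟩
      w′ t′ xor phase s′ t′ ≡⟨ cong (_xor phase s′ t′) w-t≡ ⟨
      w t xor phase s′ t′   ∎)
    w≡ : ∀ j → j < k → w (t + j) ≡ w′ (t′ + j)
    w≡ j j<k = xor-cancelʳ (P j xor (odd j ∧ phase s t)) (begin
      w (t + j) xor P j xor (odd j ∧ phase s t)      ≡⟨ orbitSeq-< {s} {w} j<k ⟨
      orbitSeq s w t j                               ≡⟨ eq j (<⇒≤ j<k) ⟩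
      orbitSeq s′ w′ t′ j                            ≡⟨ orbitSeq-< {s′} {w′} j<k ⟩
      w′ (t′ + j) xor P j xor (odd j ∧ phase s′ t′)  ≡⟨ cong (λ a → w′ (t′ + j) xor P j xor (odd j ∧ a)) phase≡ ⟨
      w′ (t′ + j) xor P j xor (odd j ∧ phase s t)    ∎)

  point-injective : ∀ s s′ w w′ → point s w ≈ₛ point s′ w′ → s ≡ s′ × w 0 ≡ w′ 0
  point-injective s s′ w w′ eq =
    let phase≡ , w≡ = orbitSeq-cancel {s} {s′} {w} {w′} {0} {0}
                        (≡-on-Fin⇒≡-on-≤ {X = orbitSeq s w 0} {Y = orbitSeq s′ w′ 0} eq)
    in trans (sym phase-0) (trans phase≡ phase-0) , w≡ 0 z<s

  record HasPeriod (s : Bool) (w : ℕ → Bool) (r : ℕ) : Set where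
    field
      twisted       : Twisted s w
      phase-period  : phase s r ≡ s
      shift-period  : ∀ j → j < k → w (r + j) ≡ w j
      shift-minimal : ∀ t → 0 < t → t < r → phase s t ≡ s → ∃[ j ] j < k × w (t + j) ≢ w j

  point-periodic : ∀ {s w r} → HasPeriod s w r → IsPeriodicPoint T r (point s w)
  point-periodic {s} {w} {r} p = returns , minimal
    where
    open HasPeriod p
    returns : iter r T (point s w) ≈ₛ point s w
    returns i = trans (iter-point {s} {w} twisted r i)
                      (orbitSeq-cong {s} {s} {w} {w} {r} {0} (trans phase-period (sym phase-0)) shift-period
                                     (toℕ i) (s≤s⁻¹ (toℕ<n i)))
    minimal : ∀ t → 0 < t → t < r → ¬ iter t T (point s w) ≈ₛ point s w
    minimal t 0<t t<r back =
      let phase≡ , w≡  = orbitSeq-cancel {s} {s} {w} {w} {t} {0} (≡-on-Fin⇒≡-on-≤ {X = orbitSeq s w t} {Y = orbitSeq s w 0}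
                                                                    λ i → trans (sym (iter-point {s} {w} twisted t i)) (back i))
          j , j<k , w≢ = shift-minimal t 0<t t<r (trans phase≡ phase-0)
      in w≢ (w≡ j j<k)

  HasPeriod-xor : ∀ {s w r} b → HasPeriod s w r → HasPeriod s (λ m → w m xor b) r
  HasPeriod-xor {s} {w} b p = record
    { twisted       = λ m → trans (cong (_xor b) (twisted m)) (swap (w m) (twist s m) b)
    ; phase-period  = phase-period
    ; shift-period  = λ j j<k → cong (_xor b) (shift-period j j<k)
    ; shift-minimal = λ t 0<t t<r phase≡ → let j , j<k , w≢ = shift-minimal t 0<t t<r phase≡
                                           in j , j<k , w≢ ∘ xor-cancelʳ b
    }
    where
    open HasPeriod p
    swap : ∀ a c b → (a xor c) xor b ≡ (a xor b) xor c
    swap = solve-∀ xorRing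

  two-periodic-points : ∀ {s w r} → HasPeriod s w r → AtLeastPeriodic 2 T r
  two-periodic-points {s} {w} {r} p =
    (x false ∷ x true ∷ []) , ≤-refl , (distinct ∷ []) ∷ [] ∷ [] , per false ∷ per true ∷ []
    where
    x : Bool → State (suc k)
    x b = point s (λ m → w m xor b)
    per : ∀ b → IsPeriodicPoint T r (x b)
    per b = point-periodic (HasPeriod-xor b p)
    distinct : ¬ x false ≈ₛ x true
    distinct eq = contradiction (xor-cancelˡ (w 0) (proj₂ (point-injective s s (λ m → w m xor false) (λ m → w m xor true) eq))) λ ()

  four-periodic-points : ∀ {w w′ r} → HasPeriod false w r → HasPeriod true w′ r → AtLeastPeriodic 4 T r
  four-periodic-points {w} {w′} {r} p p′ =
    (x false false ∷ x false true ∷ x true false ∷ x true true ∷ []) , ≤-refl ,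
    (≢b false ∷ ≢s false false ∷ ≢s false true ∷ []) ∷ (≢s true false ∷ ≢s true true ∷ []) ∷
      (≢b true ∷ []) ∷ [] ∷ [] ,
    per false false ∷ per false true ∷ per true false ∷ per true true ∷ []
    where
    seq : Bool → ℕ → Bool
    seq false = w
    seq true  = w′
    x : Bool → Bool → State (suc k)
    x s b = point s (λ m → seq s m xor b)
    per : ∀ s b → IsPeriodicPoint T r (x s b)
    per false b = point-periodic (HasPeriod-xor b p)
    per true  b = point-periodic (HasPeriod-xor b p′)
    ≢s : ∀ b b′ → ¬ x false b ≈ₛ x true b′
    ≢s b b′ eq = contradiction (proj₁ (point-injective false true (λ m → w m xor b) (λ m → w′ m xor b′) eq)) λ ()
    ≢b : ∀ s → ¬ x s false ≈ₛ x s true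
    ≢b s eq =
      contradiction (xor-cancelˡ (seq s 0) (proj₂ (point-injective s s (λ m → seq s m xor false) (λ m → seq s m xor true) eq))) λ ()

  fixed-point⇐ : ∀ {s} → C ≡ false → K xor (odd k₁ ∧ s) ≡ false → HasFixedPoint T
  fixed-point⇐ {s} C≡false K≡ = point s (λ _ → false) , proj₁ (point-periodic constant)
    where
    constant : HasPeriod s (λ _ → false) 1
    constant = record
      { twisted       = λ m → sym (trans (cong (λ a → K xor (odd k₁ ∧ a)) (phase-const C≡false (suc m))) K≡)
      ; phase-period  = phase-const C≡false 1
      ; shift-period  = λ _ _ → refl
      ; shift-minimal = λ { t 0<t (s≤s t≤0) → contradiction (<-≤-trans 0<t t≤0) (n≮n 0) }
      }

  module FixedPoint {p : State (suc k)} (Tp≈p : T p ≈ₛ p) where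

    X : ℕ → Bool
    X = extend p

    σ : Bool
    σ = X 0 xor X k

    fixed-< : ∀ j → j < k → X 0 xor X k xor X (suc j) xor D j ≡ X j
    fixed-< j j<k = subst (λ j → X 0 xor X k xor X (suc j) xor D j ≡ X j) i≡j
      (trans (sym (sdsMap-< f {X = X} (agreesWith-extend p) i (subst (_< k) (sym i≡j) j<k)))
             (trans (Tp≈p i) (agreesWith-extend p i)))
      where
      i : Fin (suc k)
      i = fromℕ< (s≤s (<⇒≤ j<k))
      i≡j : toℕ i ≡ j
      i≡j = toℕ-fromℕ< (s≤s (<⇒≤ j<k))

    fixed-last : X 1 xor C xor c 0 ≡ X k
    fixed-last = subst (λ j → X 1 xor C xor c 0 ≡ X j) i≡k
      (trans (sym (sdsMap-last f {X = X} (agreesWith-extend p) i i≡k)) (trans (Tp≈p i) (agreesWith-extend p i)))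
      where
      i : Fin (suc k)
      i = fromℕ< (n<1+n k)
      i≡k : toℕ i ≡ k
      i≡k = toℕ-fromℕ< (n<1+n k)

    C≡false : C ≡ false
    C≡false = begin
      C                                                                    ≡⟨ expand (X 0) (X k) (X 1) (c 0) C ⟩
      (X 0 xor X k xor X 1 xor c 0) xor X 0 xor (X 1 xor C xor c 0) xor X k ≡⟨ cong₂ (λ a b → a xor X 0 xor b xor X k)
                                                                                     (fixed-< 0 z<s) fixed-last ⟩
      X 0 xor X 0 xor X k xor X k                                          ≡⟨ cancel (X 0) (X k) ⟩
      false                                                                ∎
      where
      expand : ∀ a b d c C → C ≡ (a xor b xor d xor c) xor a xor (d xor C xor c) xor b
      expand = solve-∀ xorRing
      cancel : ∀ a b → a xor a xor b xor b ≡ false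
      cancel = solve-∀ xorRing

    profile : ∀ j → j < k → X j ≡ X 0 xor P j xor (odd j ∧ σ)
    profile zero    _     = units (X 0)
      where
      units : ∀ a → a ≡ a xor false xor false
      units = solve-∀ xorRing
    profile (suc j) 1+j<k = begin
      X (suc j)                                                   ≡⟨ isolate (X 0) (X k) (X (suc j)) (D j) ⟩
      (X 0 xor X k xor X (suc j) xor D j) xor X 0 xor X k xor D j ≡⟨ cong (λ a → a xor X 0 xor X k xor D j) (fixed-< j j<k) ⟩
      X j xor X 0 xor X k xor D j                                 ≡⟨ cong (λ a → a xor X 0 xor X k xor D j) (profile j j<k) ⟩
      (X 0 xor P j xor (odd j ∧ σ)) xor X 0 xor X k xor D j       ≡⟨ recombine (X 0) (X k) (P j) (D j) (odd j) ⟩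
      X 0 xor (P j xor D j xor (odd j ∧ false)) xor ((true xor odd j) ∧ σ)
        ≡⟨ cong (λ b → X 0 xor (P j xor D j xor (odd j ∧ b)) xor ((true xor odd j) ∧ σ)) C≡false ⟨
      X 0 xor P (suc j) xor (odd (suc j) ∧ σ)                     ∎
      where
      j<k : j < k
      j<k = <-trans (n<1+n j) 1+j<k
      isolate : ∀ a b e d → e ≡ (a xor b xor e xor d) xor a xor b xor d
      isolate = solve-∀ xorRing
      recombine : ∀ a b p d o → (a xor p xor (o ∧ (a xor b))) xor a xor b xor d
                                ≡ a xor (p xor d xor (o ∧ false)) xor ((true xor o) ∧ (a xor b))
      recombine = solve-∀ xorRing

    K-σ≡false : K xor (odd k₁ ∧ σ) ≡ false
    K-σ≡false = begin
      (D k₁ xor P k₁) xor (odd k₁ ∧ σ)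
        ≡⟨ expand (X 0) (X k) (D k₁) (P k₁) (odd k₁ ∧ σ) ⟩
      (X 0 xor X k xor X k xor D k₁) xor (X 0 xor P k₁ xor (odd k₁ ∧ σ)) ≡⟨ cong₂ _xor_ (sym (fixed-< k₁ (n<1+n k₁)))
                                                                                      (profile k₁ (n<1+n k₁)) ⟨
      X k₁ xor X k₁                                                     ≡⟨ xor-same (X k₁) ⟩
      false                                                             ∎
      where
      expand : ∀ a b d p e → (d xor p) xor e ≡ (a xor b xor b xor d) xor (a xor p xor e)
      expand = solve-∀ xorRing

  fixed-point⇒ : HasFixedPoint T → C ≡ false × ∃[ s ] K xor (odd k₁ ∧ s) ≡ false
  fixed-point⇒ (_ , Tp≈p) = C≡false , σ , K-σ≡false
    where open FixedPoint Tp≈p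

  multiples-period : ∀ {s h r} → h ∣ k → h ∣ r → (∀ m → twist s m ≡ false) → phase s r ≡ s →
                     (∀ t → 0 < t → t < r → phase s t ≡ s → ¬ h ∣ t) → HasPeriod s (h ∣ᵇ_) r
  multiples-period {s} {h} {r} h∣k h∣r untwisted phase-r h∤ = record
    { twisted       = λ m → trans (∣ᵇ-+ m h∣k) (sym (trans (cong ((h ∣ᵇ m) xor_) (untwisted m)) (xor-identityʳ _)))
    ; phase-period  = phase-r
    ; shift-period  = λ j _ → trans (cong (h ∣ᵇ_) (+-comm r j)) (∣ᵇ-+ j h∣r)
    ; shift-minimal = λ t 0<t t<r phase≡ → 0 , z<s , λ eq →
        contradiction (trans (sym (∤⇒∣ᵇ≡false (h∤ t 0<t t<r phase≡ ∘ subst (h ∣_) (+-identityʳ t)))) (trans eq (∣ᵇ-0 h)))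
                      λ ()
    }

  block-+k : ∀ {h} .{{_ : NonZero h}} {q} → k ≡ h * q → odd q ≡ true → ∀ m → block h (m + k) ≡ block h m xor true
  block-+k {h} {q} k≡ q-odd m = begin
    block h (m + k)        ≡⟨ cong (λ n → block h (m + n)) (trans k≡ (*-comm h q)) ⟩
    block h (m + q * h)    ≡⟨ block-+* m q ⟩
    block h m xor odd q    ≡⟨ cong (block h m xor_) q-odd ⟩
    block h m xor true     ∎

  blocks-period : ∀ {s} h .{{_ : NonZero h}} {q} → k ≡ h * q → odd q ≡ true → (∀ m → twist s m ≡ true) →
                  HasPeriod s (block h) (2 * h)
  blocks-period {s} h {q} k≡ q-odd flipped = record
    { twisted       = λ m → trans (block-+k k≡ q-odd m) (cong (block h m xor_) (sym (flipped m)))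
    ; phase-period  = phase-even h
    ; shift-period  = λ j _ → block-2*-periodic j
    ; shift-minimal = λ t 0<t t<2h _ → let j , j<h , bj , btj = block-window 0<t t<2h
                                      in j , <-≤-trans j<h h≤k , λ eq → contradiction (trans (sym btj) (trans eq bj)) λ ()
    }
    where
    h≤k : h ≤ k
    h≤k = subst (h ≤_) (sym k≡) (m≤m*n h q {{odd⇒nonZero q-odd}})

  alternating-blocks-period : ∀ {s} h .{{_ : NonZero h}} {q} a → k ≡ h * q → odd q ≡ true → odd k ≡ false →
                              C ≡ true → (∀ m → twist s m ≡ a xor odd m) →
                              HasPeriod s (λ m → block h m ∧ (a xor odd m)) (2 * h)
  alternating-blocks-period {s} h {q} a k≡ q-odd k-even C≡true alternating = record
    { twisted       = λ m → begin
        block h (m + k) ∧ (a xor odd (m + k))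
          ≡⟨ cong₂ (λ b o → b ∧ (a xor o)) (block-+k k≡ q-odd m) (trans (odd-+ m k) (cong (odd m xor_) k-even)) ⟩
        (block h m xor true) ∧ (a xor (odd m xor false))
          ≡⟨ flip (block h m) a (odd m) ⟩
        (block h m ∧ (a xor odd m)) xor (a xor odd m)
          ≡⟨ cong ((block h m ∧ (a xor odd m)) xor_) (alternating m) ⟨
        (block h m ∧ (a xor odd m)) xor twist s m
          ∎
    ; phase-period  = phase-even h
    ; shift-period  = λ j _ → cong₂ (λ b o → b ∧ (a xor o)) (block-2*-periodic j)
                                    (trans (odd-+ (2 * h) j) (cong (_xor odd j) (odd-2* h)))
    ; shift-minimal = minimal
    }
    where
    flip : ∀ b a o → (b xor true) ∧ (a xor (o xor false)) ≡ (b ∧ (a xor o)) xor (a xor o)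
    flip = solve-∀ xorRing
    h≤k : h ≤ k
    h≤k = subst (h ≤_) (sym k≡) (m≤m*n h q {{odd⇒nonZero q-odd}})
    minimal : ∀ t → 0 < t → t < 2 * h → phase s t ≡ s →
              ∃[ j ] j < k × block h (t + j) ∧ (a xor odd (t + j)) ≢ block h j ∧ (a xor odd j)
    minimal t 0<t t<2h phase≡ =
      let j , j<h , odd-j , block-j , block-t+j =
            block-window-parity {h} {t} (even⇒2≤ {t} t-even 0<t) (even<2*⇒suc< {t} {h} t-even t<2h) (not a)
          w-j : block h j ∧ (a xor odd j) ≡ false
          w-j = cong (_∧ (a xor odd j)) block-j
          w-t+j : block h (t + j) ∧ (a xor odd (t + j)) ≡ true
          w-t+j = trans (cong₂ (λ b o → b ∧ (a xor o)) block-t+j (trans (odd-+ t j) (cong₂ _xor_ t-even odd-j))) (xor-inverseʳ a)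
      in j , <-≤-trans j<h h≤k , λ eq → contradiction (trans (sym w-t+j) (trans eq w-j)) λ ()
      where
      t-even : odd t ≡ false
      t-even = phase-period⇒even {s} {t} C≡true phase≡

  periodic-points-with-fixed-point : ∀ {r} → 0 < r → HasFixedPoint T → r ∣ cycleLen (suc k) → AtLeastPeriodic 2 T r
  periodic-points-with-fixed-point {r} 0<r fixed r∣cycle = by-divisibility (r ∣? k)
    where
    C≡false : C ≡ false
    C≡false = proj₁ (fixed-point⇒ fixed)
    s : Bool
    s = proj₁ (proj₂ (fixed-point⇒ fixed))
    K≡ : K xor (odd k₁ ∧ s) ≡ false
    K≡ = proj₂ (proj₂ (fixed-point⇒ fixed))
    by-divisibility : Dec (r ∣ k) → AtLeastPeriodic 2 T r
    by-divisibility (yes r∣k) =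
      two-periodic-points {s} {r ∣ᵇ_} {r}
        (multiples-period {s} {r} {r} r∣k ∣-refl (λ m → trans (twist-C≡false {s} C≡false m) K≡) (phase-const C≡false r)
                          λ t 0<t t<r _ r∣t → <⇒≱ t<r (∣⇒≤ {{>-nonZero 0<t}} r∣t))
    by-divisibility (no r∤k) with ∣cycleLen⇒ {k} {r} 0<r r∣cycle r∤k
    ... | k-even , h , q , r≡ , k≡ , q-odd =
      subst (AtLeastPeriodic 2 T) (sym r≡)
            (two-periodic-points {not s} {block (suc h)} {2 * suc h} (blocks-period {not s} (suc h) {q} k≡ q-odd flipped))
      where
      k₁-odd : odd k₁ ≡ true
      k₁-odd = trans (sym (not-involutive (odd k₁))) (cong not k-even)
      flipped : ∀ m → twist (not s) m ≡ true
      flipped m = begin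
        twist (not s) m          ≡⟨ twist-C≡false {not s} C≡false m ⟩
        K xor (odd k₁ ∧ not s)   ≡⟨ cong (λ o → K xor (o ∧ not s)) k₁-odd ⟩
        K xor not s              ≡⟨ not-distribʳ-xor K s ⟨
        not (K xor s)            ≡⟨ cong (λ o → not (K xor (o ∧ s))) k₁-odd ⟨
        not (K xor (odd k₁ ∧ s)) ≡⟨ cong not K≡ ⟩
        true                     ∎

  four-periodic-points-of-double : ∀ h {q} → k ≡ suc h * q → odd q ≡ true → ¬ HasFixedPoint T →
                                   AtLeastPeriodic 4 T (2 * suc h)
  four-periodic-points-of-double h {q} k≡ q-odd no-fixed = by-parameters (odd k₁) refl K refl C refl
    where
    by-parameters : ∀ o → odd k₁ ≡ o → ∀ κ → K ≡ κ → ∀ c → C ≡ c → AtLeastPeriodic 4 T (2 * suc h)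
    by-parameters true k₁-odd _ _ false C≡false =
      contradiction (fixed-point⇐ {K} C≡false (trans (cong (λ o → K xor (o ∧ K)) k₁-odd) (xor-same K))) no-fixed
    by-parameters false k₁-even false K≡false false C≡false =
      contradiction (fixed-point⇐ {false} C≡false
                       (trans (cong (λ o → K xor (o ∧ false)) k₁-even) (trans (xor-identityʳ K) K≡false)))
                    no-fixed
    by-parameters false k₁-even true K≡true _ _ =
      four-periodic-points {block (suc h)} {block (suc h)} {2 * suc h} (blocks false) (blocks true)
      where
      blocks : ∀ s → HasPeriod s (block (suc h)) (2 * suc h)
      blocks s = blocks-period {s} (suc h) {q} k≡ q-odd (λ m → trans (twist-k-odd {s} k₁-even m) K≡true)
    by-parameters false k₁-even false K≡false true C≡true =
      four-periodic-points {suc h ∣ᵇ_} {suc h ∣ᵇ_} {2 * suc h} (multiples false) (multiples true)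
      where
      h-odd : odd (suc h) ≡ true
      h-odd = trans (sym (odd-*-oddʳ (suc h) {q} q-odd)) (trans (cong odd (sym k≡)) (cong not k₁-even))
      multiples : ∀ s → HasPeriod s (suc h ∣ᵇ_) (2 * suc h)
      multiples s = multiples-period {s} {suc h} {2 * suc h} (divides q (trans k≡ (*-comm (suc h) q))) (n∣m*n 2)
                      (λ m → trans (twist-k-odd {s} k₁-even m) K≡false) (phase-even (suc h))
                      λ t 0<t t<2h phase≡ → odd∤even h-odd (phase-period⇒even {s} {t} C≡true phase≡) 0<t t<2h
    by-parameters true k₁-odd _ _ true C≡true =
      four-periodic-points (alternating false) (alternating true)
      where
      alternating : ∀ s → HasPeriod s (λ m → block (suc h) m ∧ ((K xor not s) xor odd m)) (2 * suc h)
      alternating s = alternating-blocks-period {s} (suc h) {q} (K xor not s) k≡ q-odd (cong not k₁-odd) C≡true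
                        (twist-alternating {s} k₁-odd C≡true)

  periodic-points-without-fixed-point : ∀ {r} → 0 < r → ¬ HasFixedPoint T →
                                        (Σ ℕ λ m → m * r ≡ 2 * suc k ∸ 2 × Σ ℕ λ j → m ≡ suc (2 * j)) →
                                        AtLeastPeriodic 4 T r
  periodic-points-without-fixed-point {r} 0<r no-fixed (m , m*r≡ , j , m≡) =
    let m-odd : odd m ≡ true
        m-odd = trans (cong odd m≡) (cong not (odd-2* j))
        h , r≡ , k≡ = positive-odd-quotient {r} {m} {k} 0<r m-odd (trans (*-comm r m) (trans m*r≡ (2*suc∸2 k)))
    in subst (AtLeastPeriodic 4 T) (sym r≡) (four-periodic-points-of-double h k≡ m-odd no-fixed)

corollary4p10 : (k r : ℕ) → 3 ≤ suc k → 1 ≤ r → (f : Fin (suc k) → Bool) →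
    ((HasFixedPoint (sdsMap f) → r ∣ cycleLen (suc k) →
        AtLeastPeriodic 2 (sdsMap f) r)
    × (¬ HasFixedPoint (sdsMap f) → (Σ ℕ λ m → m * r ≡ 2 * suc k ∸ 2 × Σ ℕ λ j → m ≡ suc (2 * j)) →
        AtLeastPeriodic 4 (sdsMap f) r))
corollary4p10 (suc (suc k₂)) r _ 0<r f =
  periodic-points-with-fixed-point 0<r , periodic-points-without-fixed-point 0<r
  where open Orbits f
corollary4p10 zero          _ (s≤s ())       _   _
corollary4p10 (suc zero)    _ (s≤s (s≤s ())) _   _
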